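{- Let $K$ be a $^*$-continuous KAT with top, $A$ a top Kleene abstract domain of $K$ with maps $\alpha,\gamma$, and $T_{\Sigma,B}$ a KAT language interpreted on $K$ through a pair-valued evaluation. Every triple derivable in the proof system $\mathrm{LCTIL}_A$ is valid.
   Context: Idempotent semiring: $(K,+,0)$ commutative monoid with $a+a=a$, $(K,\cdot,1)$ monoid, two-sided distributivity, $0a=a0=0$; $a\le b$ iff $a+b=b$. KAT: idempotent semiring with Boolean subalgebra $\mathrm{Test}(K)$ (join $+$, meet $\cdot$, complement, bottom $0$, top $1$) and ${}^*$ with $1+aa^*\le a^*$, $1+a^*a\le a^*$, $b+ac\le c\Rightarrow a^*b\le c$, $b+ca\le c\Rightarrow ba^*\le c$. TopKAT: KAT with greatest element $\top$; $^*$-continuous: $\bigvee_nab^nc$ exists and equals $ab^*c$ for all $a,b,c$. $\mathrm{TOP}(K)=\{\top a\mid a\in K\}$. Language: disjoint $\Sigma,B$ ($\mathtt0,\mathtt1\in B$), $\mathrm{Atom}=\Sigma\cup B$, terms $t::=\mathtt a\mid\mathtt0\mid\mathtt1\mid t_1+t_2\mid t_1\cdot t_2\mid t^*$. Evaluation $u:\mathrm{Atom}\to K\times K$ induces $\llbracket t\rrbracket=(\llbracket t\rrbracket_{ok},\llbracket t\rrbracket_{err})$: $\llbracket\mathtt a\rrbracket=u(\mathtt a)$; $\llbracket t_1+t_2\rrbracket$ componentwise sum; $\llbracket t_1\cdot t_2\rrbracket=(\llbracket t_1\rrbracket_{ok}\llbracket t_2\rrbracket_{ok},\llbracket t_1\rrbracket_{err}+\llbracket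 t_1\rrbracket_{ok}\llbracket t_2\rrbracket_{err})$; $\llbracket t^*\rrbracket=(\llbracket t\rrbracket_{ok}^*,\llbracket t\rrbracket_{ok}^*\llbracket t\rrbracket_{err})$. Top Kleene abstract domain: poset $A$, Galois insertion $\alpha:\mathrm{TOP}(K)\to A$, $\gamma:A\to\mathrm{TOP}(K)$ ($\alpha(x)\le_Ay\iff x\le\gamma(y)$, $\alpha\gamma=\mathrm{id}$), countably complete. Abstract semantics ($\varepsilon\in\{ok,err\}$): $\mathcal S^\sharp_\varepsilon[\mathtt c]x=\alpha(\gamma(x)\llbracket\mathtt c\rrbracket_\varepsilon)$; $\mathcal S^\sharp_\varepsilon[t_1+t_2]x=\mathcal S^\sharp_\varepsilon[t_1]x\vee_A\mathcal S^\sharp_\varepsilon[t_2]x$; $\mathcal S^\sharp_{ok}[t_1\cdot t_2]x=\mathcal S^\sharp_{ok}[t_2](\mathcal S^\sharp_{ok}[t_1]x)$; $\mathcal S^\sharp_{err}[t_1\cdot t_2]x=\mathcal S^\sharp_{err}[t_1]x\vee_A\mathcal S^\sharp_{err}[t_2](\mathcal S^\sharp_{ok}[t_1]x)$; $\mathcal S^\sharp_{ok}[t^*]x=\bigvee_n(\mathcal S^\sharp_{ok}[t])^nx$; $\mathcal S^\sharp_{err}[t^*]x=\mathcal S^\sharp_{err}[t](\bigvee_n(\mathcal S^\sharp_{ok}[t])^nx)$. $A(x):=\gamma\alpha(x)$; $\mathbb C^A_b(c)$ iff $A(\top bc)=A(A(\top b)c)$. Triples $[a]t[\varepsilon:b]$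 with $a,b\in K$; valid iff $\top b\le\top a\llbracket t\rrbracket_\varepsilon$ and $\mathcal S^\sharp_\varepsilon[t]\alpha(\top a)=\alpha(\top b)=\alpha(\top a\llbracket t\rrbracket_\varepsilon)$. $[a]t[ok:b][err:c]$ stands for both $[a]t[ok:b]$ and $[a]t[err:c]$. $\mathrm{LCTIL}_A$ rules ($\varepsilon$-rules are schemes for each $\varepsilon$): (transfer) $\mathtt c\in\mathrm{Atom}$, $\mathbb C^A_a(\llbracket\mathtt c\rrbracket_{ok})$, $\mathbb C^A_a(\llbracket\mathtt c\rrbracket_{err})$ $\vdash[a]\mathtt c[ok:a\llbracket\mathtt c\rrbracket_{ok}][err:a\llbracket\mathtt c\rrbracket_{err}]$; (relax) $\top a'\le\top a\le A(\top a')$, $[a']t[\varepsilon:b']$, $\top b\le\top b'\le A(\top b)$ $\vdash[a]t[\varepsilon:b]$; (seq-ok) $[a]t_1[ok:r]$, $[r]t_2[ok:b]$ $\vdash[a]t_1\cdot t_2[ok:b]$; (seq-err) $[a]t_1[ok:b][err:r]$, $[b]t_2[err:s]$ $\vdash[a]t_1\cdot t_2[err:r+s]$; (rec-err) $[a]t^*[ok:b]$, $[b]t[err:r]$ $\vdash[a]t^*[err:r]$; (join) $[a]t_1[\varepsilon:b_1]$, $[a]t_2[\varepsilon:b_2]$ $\vdash[a]t_1+t_2[\varepsilon:b_1+b_2]$; (limit) $[a_n]t[ok:a_{n+1}]$ for all $n$ $\vdash[a_0]t^*[ok:\bigvee_na_n]$, applicable only when $\bigvee_na_n$ exists and $\top\bigvee_na_n=\bigvee_n\top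 a_n$. -}

module Defs where

open import Level using (Level; _⊔_) renaming (suc to lsuc)
open import Data.Nat using (ℕ; zero; suc)
open import Data.Product using (Σ; ∃; _×_; _,_; proj₁; proj₂)
open import Data.Sum using (_⊎_)
open import Relation.Binary.PropositionalEquality using (_≡_; refl; sym; trans; cong)
open import Relation.Binary.Structures using (IsPartialOrder)

record IsLubOf {c ℓ} {X : Set c} (_≤_ : X → X → Set ℓ)
               (f : ℕ → X) (s : X) : Set (c ⊔ ℓ) where
  field
    upper : ∀ n → f n ≤ s
    least : ∀ y → (∀ n → f n ≤ y) → s ≤ y

pow : ∀ {c} {X : Set c} → (X → X → X) → X → X → ℕ → X
pow _·_ one b zero    = one
pow _·_ one b (suc n) = b · pow _·_ one b n

record StarContTopKAT (c : Level) : Set (lsuc c) where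
  infixl 6 _+_
  infixl 7 _·_
  infix  8 _*
  field
    Carrier : Set c
    _+_ _·_ : Carrier → Carrier → Carrier
    0# 1#   : Carrier
    _*      : Carrier → Carrier
    +-assoc     : ∀ a b d → (a + b) + d ≡ a + (b + d)
    +-comm      : ∀ a b → a + b ≡ b + a
    +-identityˡ : ∀ a → 0# + a ≡ a
    +-idem      : ∀ a → a + a ≡ a
    ·-assoc     : ∀ a b d → (a · b) · d ≡ a · (b · d)
    ·-identityˡ : ∀ a → 1# · a ≡ a
    ·-identityʳ : ∀ a → a · 1# ≡ a
    distribˡ    : ∀ a b d → a · (b + d) ≡ a · b + a · d
    distribʳ    : ∀ a b d → (b + d) · a ≡ b · a + d · a
    zeroˡ       : ∀ a → 0# · a ≡ 0#
    zeroʳ       : ∀ a → a · 0# ≡ 0#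

  infix 4 _≤_
  _≤_ : Carrier → Carrier → Set c
  a ≤ b = a + b ≡ b

  field
    IsTest     : Carrier → Set c
    test-0     : IsTest 0#
    test-1     : IsTest 1#
    test-+     : ∀ {a b} → IsTest a → IsTest b → IsTest (a + b)
    test-·     : ∀ {a b} → IsTest a → IsTest b → IsTest (a · b)
    test-neg   : ∀ a → IsTest a → Carrier
    test-neg-t : ∀ a (p : IsTest a) → IsTest (test-neg a p)
    test-compl-join : ∀ a (p : IsTest a) → a + test-neg a p ≡ 1#
    test-compl-meet : ∀ a (p : IsTest a) → a · test-neg a p ≡ 0#
    test-·-comm : ∀ {a b} → IsTest a → IsTest b → a · b ≡ b · a
    test-·-idem : ∀ {a} → IsTest a → a · a ≡ a
    *-unfoldˡ : ∀ a → 1# + a · a * ≤ a *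
    *-unfoldʳ : ∀ a → 1# + a * · a ≤ a *
    *-indˡ    : ∀ a b d → b + a · d ≤ d → a * · b ≤ d
    *-indʳ    : ∀ a b d → b + d · a ≤ d → b · a * ≤ d
    ⊤     : Carrier
    ⊤-max : ∀ a → a ≤ ⊤
    *-cont : ∀ a b d → IsLubOf _≤_ (λ n → a · pow _·_ 1# b n · d) (a · b * · d)

  TOP : Set c
  TOP = Σ Carrier (λ x → ∃ λ a → x ≡ ⊤ · a)

  ⟨⊤_⟩ : Carrier → TOP
  ⟨⊤ a ⟩ = ⊤ · a , a , refl

  _·T_ : TOP → Carrier → TOP
  (x , a , eq) ·T k = x · k , a · k , trans (cong (_· k) eq) (·-assoc ⊤ a k)

record TopKleeneAbsDomain {c} (K : StarContTopKAT c) (a ℓ : Level)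
       : Set (c ⊔ lsuc a ⊔ lsuc ℓ) where
  open StarContTopKAT K
  field
    Abs : Set a
    _⊑_ : Abs → Abs → Set ℓ
    ⊑-isPartialOrder : IsPartialOrder _≡_ _⊑_
    α : TOP → Abs
    γ : Abs → TOP
    galois→ : ∀ x y → α x ⊑ y → proj₁ x ≤ proj₁ (γ y)
    galois← : ∀ x y → proj₁ x ≤ proj₁ (γ y) → α x ⊑ y
    αγ      : ∀ y → α (γ y) ≡ y
    ⊥A   : Abs
    ⊥A-least : ∀ y → ⊥A ⊑ y
    ⋁    : (ℕ → Abs) → Abs
    ⋁-lub : ∀ f → IsLubOf _⊑_ f (⋁ f)

  _∨A_ : Abs → Abs → Abs
  x ∨A y = ⋁ (λ { zero → x ; (suc _) → y })

  Aop : TOP → TOP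
  Aop x = γ (α x)

  Compl : Carrier → Carrier → Set c
  Compl b d = proj₁ (Aop ⟨⊤ b · d ⟩) ≡ proj₁ (Aop (Aop ⟨⊤ b ⟩ ·T d))

-- KAT language T_{Σ,B}: atoms are Σ ⊎ B (with 𝟶, 𝟷 ∈ B)

data Term {s} (Sig B : Set s) : Set s where
  atom : Sig ⊎ B → Term Sig B
  _⊕_  : Term Sig B → Term Sig B → Term Sig B
  _⊙_  : Term Sig B → Term Sig B → Term Sig B
  _⋆   : Term Sig B → Term Sig B

data Exit : Set where
  ok err : Exit

module Semantics {c s} (K : StarContTopKAT c) {Sig B : Set s}
                 (u : Sig ⊎ B → StarContTopKAT.Carrier K × StarContTopKAT.Carrier K) where
  open StarContTopKAT K

  ⟦_⟧ : Term Sig B → Carrier × Carrier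
  ⟦ atom x ⟧ = u x
  ⟦ t₁ ⊕ t₂ ⟧ = proj₁ ⟦ t₁ ⟧ + proj₁ ⟦ t₂ ⟧ , proj₂ ⟦ t₁ ⟧ + proj₂ ⟦ t₂ ⟧
  ⟦ t₁ ⊙ t₂ ⟧ = proj₁ ⟦ t₁ ⟧ · proj₁ ⟦ t₂ ⟧ , proj₂ ⟦ t₁ ⟧ + proj₁ ⟦ t₁ ⟧ · proj₂ ⟦ t₂ ⟧
  ⟦ t ⋆ ⟧ = proj₁ ⟦ t ⟧ * , proj₁ ⟦ t ⟧ * · proj₂ ⟦ t ⟧

  ⟦_⟧[_] : Term Sig B → Exit → Carrier
  ⟦ t ⟧[ ok ]  = proj₁ ⟦ t ⟧
  ⟦ t ⟧[ err ] = proj₂ ⟦ t ⟧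

  module Abstract {a ℓ} (D : TopKleeneAbsDomain K a ℓ) where
    open TopKleeneAbsDomain D

    iter : (Abs → Abs) → ℕ → Abs → Abs
    iter f zero x    = x
    iter f (suc n) x = f (iter f n x)

    S♯ : Exit → Term Sig B → Abs → Abs
    S♯ ε (atom x) y = α (γ y ·T ⟦ atom x ⟧[ ε ])
    S♯ ε (t₁ ⊕ t₂) y = S♯ ε t₁ y ∨A S♯ ε t₂ y
    S♯ ok (t₁ ⊙ t₂) y = S♯ ok t₂ (S♯ ok t₁ y)
    S♯ err (t₁ ⊙ t₂) y = S♯ err t₁ y ∨A S♯ err t₂ (S♯ ok t₁ y)
    S♯ ok (t ⋆) y = ⋁ (λ n → iter (S♯ ok t) n y)
    S♯ err (t ⋆) y = S♯ err t (⋁ (λ n → iter (S♯ ok t) n y))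

    Valid : Carrier → Term Sig B → Exit → Carrier → Set (c ⊔ a)
    Valid p t ε q =
      (⊤ · q ≤ ⊤ · p · ⟦ t ⟧[ ε ]) ×
      (S♯ ε t (α ⟨⊤ p ⟩) ≡ α ⟨⊤ q ⟩) ×
      (α ⟨⊤ q ⟩ ≡ α ⟨⊤ p · ⟦ t ⟧[ ε ] ⟩)

    data ⊢[_]_[_∶_] : Carrier → Term Sig B → Exit → Carrier → Set (c ⊔ s ⊔ a) where
      transfer : ∀ {p} (x : Sig ⊎ B) ε →
        Compl p ⟦ atom x ⟧[ ok ] → Compl p ⟦ atom x ⟧[ err ] →
        ⊢[ p ] atom x [ ε ∶ p · ⟦ atom x ⟧[ ε ] ]
      relax : ∀ {p p' q q' t ε} →
        ⊤ · p' ≤ ⊤ · p → ⊤ · p ≤ proj₁ (Aop ⟨⊤ p' ⟩) →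
        ⊢[ p' ] t [ ε ∶ q' ] →
        ⊤ · q ≤ ⊤ · q' → ⊤ · q' ≤ proj₁ (Aop ⟨⊤ q ⟩) →
        ⊢[ p ] t [ ε ∶ q ]
      seq-ok : ∀ {p r q t₁ t₂} →
        ⊢[ p ] t₁ [ ok ∶ r ] → ⊢[ r ] t₂ [ ok ∶ q ] →
        ⊢[ p ] t₁ ⊙ t₂ [ ok ∶ q ]
      seq-err : ∀ {p q r r' t₁ t₂} →
        ⊢[ p ] t₁ [ ok ∶ q ] → ⊢[ p ] t₁ [ err ∶ r ] →
        ⊢[ q ] t₂ [ err ∶ r' ] →
        ⊢[ p ] t₁ ⊙ t₂ [ err ∶ r + r' ]
      rec-err : ∀ {p q r t} →
        ⊢[ p ] t ⋆ [ ok ∶ q ] → ⊢[ q ] t [ err ∶ r ] →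
        ⊢[ p ] t ⋆ [ err ∶ r ]
      join : ∀ {p q₁ q₂ t₁ t₂ ε} →
        ⊢[ p ] t₁ [ ε ∶ q₁ ] → ⊢[ p ] t₂ [ ε ∶ q₂ ] →
        ⊢[ p ] t₁ ⊕ t₂ [ ε ∶ q₁ + q₂ ]
      limit : ∀ {t} (as : ℕ → Carrier) (sup : Carrier) →
        IsLubOf _≤_ as sup →
        IsLubOf _≤_ (λ n → ⊤ · as n) (⊤ · sup) →
        (∀ n → ⊢[ as n ] t [ ok ∶ as (suc n) ]) →
        ⊢[ as zero ] t ⋆ [ ok ∶ sup ]

{-# OPTIONS --safe #-}
-- The abstract semantics is
-- monotone and sound, α(⊤ a ⟦t⟧) ⊑ S♯[t] α(⊤ a); hence the last validity
-- condition α(⊤ b) = α(⊤ a ⟦t⟧) follows from the other two, and each rule only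
-- has to propagate the under-approximation ⊤ b ≤ ⊤ a ⟦t⟧ and the equation
-- S♯[t] α(⊤ a) = α(⊤ b). For iteration, *-continuity presents ⊤ a ⟦t⟧* as the
-- supremum of the ⊤ a ⟦t⟧ⁿ, and α, being a left adjoint, preserves it.
module Submission where

open import Level using (Level)
open import Data.Nat using (ℕ; zero; suc)
open import Data.Product using (_×_; _,_; proj₁)
open import Data.Sum using (_⊎_)
open import Function using (_∘_)
open import Relation.Binary.Bundles using (Poset)
open import Relation.Binary.Structures using (IsPartialOrder)
open import Relation.Binary.PropositionalEquality
  using (_≡_; refl; sym; trans; cong; cong₂; subst; isEquivalence; module ≡-Reasoning)
import Relation.Binary.Reasoning.PartialOrder as PosetReasoning
open import Defs

open IsLubOf

IsLubOf-resp : ∀ {c ℓ} {X : Set c} {R : X → X → Set ℓ} {f g : ℕ → X} {s s' : X} →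
               (∀ n → f n ≡ g n) → s ≡ s' → IsLubOf R f s → IsLubOf R g s'
IsLubOf-resp {R = R} f≡g refl lub = record
  { upper = λ n → subst (λ z → R z _) (f≡g n) (upper lub n)
  ; least = λ y g≤y → least lub y (λ n → subst (λ z → R z y) (sym (f≡g n)) (g≤y n))
  }

module KleeneOrder {c} (K : StarContTopKAT c) where
  open StarContTopKAT K

  ≤-refl : ∀ {x} → x ≤ x
  ≤-refl {x} = +-idem x

  ≤-reflexive : ∀ {x y} → x ≡ y → x ≤ y
  ≤-reflexive refl = ≤-refl

  ≤-trans : ∀ {x y z} → x ≤ y → y ≤ z → x ≤ z
  ≤-trans {x} {y} {z} x≤y y≤z = begin
    x + z        ≡⟨ cong (x +_) (sym y≤z) ⟩
    x + (y + z)  ≡⟨ sym (+-assoc x y z) ⟩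
    (x + y) + z  ≡⟨ cong (_+ z) x≤y ⟩
    y + z        ≡⟨ y≤z ⟩
    z            ∎
    where open ≡-Reasoning

  ≤-antisym : ∀ {x y} → x ≤ y → y ≤ x → x ≡ y
  ≤-antisym {x} {y} x≤y y≤x = trans (sym y≤x) (trans (+-comm y x) x≤y)

  ≤-poset : Poset c c c
  ≤-poset = record
    { Carrier = Carrier ; _≈_ = _≡_ ; _≤_ = _≤_
    ; isPartialOrder = record
      { isPreorder = record
        { isEquivalence = isEquivalence ; reflexive = ≤-reflexive ; trans = ≤-trans }
      ; antisym = ≤-antisym
      }
    }

  module ≤-Reasoning = PosetReasoning ≤-poset

  x≤x+y : ∀ {x y} → x ≤ x + y
  x≤x+y {x} {y} = trans (sym (+-assoc x x y)) (cong (_+ y) (+-idem x))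

  y≤x+y : ∀ {x y} → y ≤ x + y
  y≤x+y {x} {y} = subst (y ≤_) (+-comm y x) x≤x+y

  +-lub : ∀ {x y z} → x ≤ z → y ≤ z → x + y ≤ z
  +-lub {x} {y} {z} x≤z y≤z = trans (+-assoc x y z) (trans (cong (x +_) y≤z) x≤z)

  +-mono-≤ : ∀ {x x' y y'} → x ≤ x' → y ≤ y' → x + y ≤ x' + y'
  +-mono-≤ x≤x' y≤y' = +-lub (≤-trans x≤x' x≤x+y) (≤-trans y≤y' y≤x+y)

  ·-monoˡ-≤ : ∀ {x y} d → x ≤ y → x · d ≤ y · d
  ·-monoˡ-≤ {x} {y} d x≤y = trans (sym (distribʳ d x y)) (cong (_· d) x≤y)

  ·-monoʳ-≤ : ∀ {x y} d → x ≤ y → d · x ≤ d · y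
  ·-monoʳ-≤ {x} {y} d x≤y = trans (sym (distribˡ d x y)) (cong (d ·_) x≤y)

  infixr 8 _^_
  _^_ : Carrier → ℕ → Carrier
  b ^ n = pow _·_ 1# b n

  ^-suc-comm : ∀ b n → b ^ suc n ≡ b ^ n · b
  ^-suc-comm b zero    = trans (·-identityʳ b) (sym (·-identityˡ b))
  ^-suc-comm b (suc n) = trans (cong (b ·_) (^-suc-comm b n)) (sym (·-assoc b (b ^ n) b))

  *-lub : ∀ a b → IsLubOf _≤_ (λ n → a · b ^ n) (a · b *)
  *-lub a b = IsLubOf-resp (λ n → ·-identityʳ (a · b ^ n)) (·-identityʳ (a · b *)) (*-cont a b 1#)

  ⊤-reach-· : ∀ {p q r c₁ c₂} → ⊤ · r ≤ ⊤ · p · c₁ → ⊤ · q ≤ ⊤ · r · c₂ →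
              ⊤ · q ≤ ⊤ · p · (c₁ · c₂)
  ⊤-reach-· {p} {q} {r} {c₁} {c₂} r≤pc₁ q≤rc₂ = begin
    ⊤ · q              ≤⟨ q≤rc₂ ⟩
    ⊤ · r · c₂         ≤⟨ ·-monoˡ-≤ c₂ r≤pc₁ ⟩
    ⊤ · p · c₁ · c₂    ≡⟨ ·-assoc (⊤ · p) c₁ c₂ ⟩
    ⊤ · p · (c₁ · c₂)  ∎
    where open ≤-Reasoning

  ⊤-reach-+ : ∀ {p q₁ q₂ c₁ c₂} → ⊤ · q₁ ≤ ⊤ · p · c₁ → ⊤ · q₂ ≤ ⊤ · p · c₂ →
              ⊤ · (q₁ + q₂) ≤ ⊤ · p · (c₁ + c₂)
  ⊤-reach-+ {p} {q₁} {q₂} {c₁} {c₂} q₁≤pc₁ q₂≤pc₂ = begin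
    ⊤ · (q₁ + q₂)          ≡⟨ distribˡ ⊤ q₁ q₂ ⟩
    ⊤ · q₁ + ⊤ · q₂        ≤⟨ +-mono-≤ q₁≤pc₁ q₂≤pc₂ ⟩
    ⊤ · p · c₁ + ⊤ · p · c₂ ≡⟨ sym (distribˡ (⊤ · p) c₁ c₂) ⟩
    ⊤ · p · (c₁ + c₂)      ∎
    where open ≤-Reasoning

module GaloisInsertion {c a ℓ} {K : StarContTopKAT c} (D : TopKleeneAbsDomain K a ℓ) where
  open StarContTopKAT K
  open TopKleeneAbsDomain D
  open KleeneOrder K

  module ⊑ = IsPartialOrder ⊑-isPartialOrder

  ⊑-poset : Poset a a ℓ
  ⊑-poset = record { Carrier = Abs ; _≈_ = _≡_ ; _≤_ = _⊑_ ; isPartialOrder = ⊑-isPartialOrder }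

  module ⊑-Reasoning = PosetReasoning ⊑-poset

  α⊤ : Carrier → Abs
  α⊤ x = α ⟨⊤ x ⟩

  Aop-extensive : ∀ x → proj₁ x ≤ proj₁ (Aop x)
  Aop-extensive x = galois→ x (α x) ⊑.refl

  α-mono : ∀ {x y} → proj₁ x ≤ proj₁ y → α x ⊑ α y
  α-mono {x} {y} x≤y = galois← x (α y) (≤-trans x≤y (Aop-extensive y))

  γ-mono : ∀ {y y'} → y ⊑ y' → proj₁ (γ y) ≤ proj₁ (γ y')
  γ-mono {y} {y'} y⊑y' = galois→ (γ y) y' (subst (_⊑ y') (sym (αγ y)) y⊑y')

  α-cong-Aop : ∀ {x y} → proj₁ (Aop x) ≡ proj₁ (Aop y) → α x ≡ α y
  α-cong-Aop {x} {y} Ax≡Ay = ⊑.antisym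
    (galois← x (α y) (subst (proj₁ x ≤_) Ax≡Ay (Aop-extensive x)))
    (galois← y (α x) (subst (proj₁ y ≤_) (sym Ax≡Ay) (Aop-extensive y)))

  α⊤-absorb : ∀ {x y} → ⊤ · x ≤ ⊤ · y → ⊤ · y ≤ proj₁ (Aop ⟨⊤ x ⟩) → α⊤ y ≡ α⊤ x
  α⊤-absorb {x} {y} x≤y y≤Ax = ⊑.antisym (galois← ⟨⊤ y ⟩ (α⊤ x) y≤Ax) (α-mono x≤y)

  ⋁-mono : ∀ {f g} → (∀ n → f n ⊑ g n) → ⋁ f ⊑ ⋁ g
  ⋁-mono {f} {g} f⊑g = least (⋁-lub f) (⋁ g) (λ n → ⊑.trans (f⊑g n) (upper (⋁-lub g) n))

  ⋁-cong : ∀ {f g} → (∀ n → f n ≡ g n) → ⋁ f ≡ ⋁ g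
  ⋁-cong f≡g = ⊑.antisym (⋁-mono (⊑.reflexive ∘ f≡g)) (⋁-mono (⊑.reflexive ∘ sym ∘ f≡g))

  ∨A-mono : ∀ {x x' y y'} → x ⊑ x' → y ⊑ y' → (x ∨A y) ⊑ (x' ∨A y')
  ∨A-mono x⊑x' y⊑y' = ⋁-mono λ { zero → x⊑x' ; (suc _) → y⊑y' }

  x⊑x∨Ay : ∀ {x y} → x ⊑ (x ∨A y)
  x⊑x∨Ay = upper (⋁-lub _) zero

  y⊑x∨Ay : ∀ {x y} → y ⊑ (x ∨A y)
  y⊑x∨Ay = upper (⋁-lub _) (suc zero)

  ∨A-least : ∀ {x y z} → x ⊑ z → y ⊑ z → (x ∨A y) ⊑ z
  ∨A-least x⊑z y⊑z = least (⋁-lub _) _ λ { zero → x⊑z ; (suc _) → y⊑z }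

  α⊤-+ : ∀ x y → α⊤ (x + y) ≡ α⊤ x ∨A α⊤ y
  α⊤-+ x y = ⊑.antisym
    (galois← ⟨⊤ x + y ⟩ _ (subst (_≤ proj₁ (γ (α⊤ x ∨A α⊤ y))) (sym (distribˡ ⊤ x y))
      (+-lub (≤-trans (Aop-extensive ⟨⊤ x ⟩) (γ-mono x⊑x∨Ay))
             (≤-trans (Aop-extensive ⟨⊤ y ⟩) (γ-mono y⊑x∨Ay)))))
    (∨A-least (α-mono (·-monoʳ-≤ ⊤ x≤x+y)) (α-mono (·-monoʳ-≤ ⊤ y≤x+y)))

  α⊤-⋁ : ∀ {g l} → IsLubOf _≤_ (λ n → ⊤ · g n) (⊤ · l) → α⊤ l ≡ ⋁ (α⊤ ∘ g)
  α⊤-⋁ {g} {l} lub = ⊑.antisym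
    (galois← ⟨⊤ l ⟩ _ (least lub _ λ n →
      ≤-trans (Aop-extensive ⟨⊤ g n ⟩) (γ-mono (upper (⋁-lub (α⊤ ∘ g)) n))))
    (least (⋁-lub (α⊤ ∘ g)) _ λ n → α-mono (upper lub n))

module Soundness {c a ℓ s : Level} (K : StarContTopKAT c) (D : TopKleeneAbsDomain K a ℓ)
                 {Sig B : Set s}
                 (u : Sig ⊎ B → StarContTopKAT.Carrier K × StarContTopKAT.Carrier K) where
  open StarContTopKAT K
  open TopKleeneAbsDomain D
  open KleeneOrder K
  open GaloisInsertion D
  open Semantics K u
  open Abstract D

  iter-mono : ∀ {f} → (∀ {x y} → x ⊑ y → f x ⊑ f y) →
              ∀ n {x y} → x ⊑ y → iter f n x ⊑ iter f n y
  iter-mono f-mono zero    x⊑y = x⊑y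
  iter-mono f-mono (suc n) x⊑y = f-mono (iter-mono f-mono n x⊑y)

  S♯-mono : ∀ ε t {x y} → x ⊑ y → S♯ ε t x ⊑ S♯ ε t y
  S♯-mono ε   (atom z)  x⊑y = α-mono (·-monoˡ-≤ _ (γ-mono x⊑y))
  S♯-mono ε   (t₁ ⊕ t₂) x⊑y = ∨A-mono (S♯-mono ε t₁ x⊑y) (S♯-mono ε t₂ x⊑y)
  S♯-mono ok  (t₁ ⊙ t₂) x⊑y = S♯-mono ok t₂ (S♯-mono ok t₁ x⊑y)
  S♯-mono err (t₁ ⊙ t₂) x⊑y = ∨A-mono (S♯-mono err t₁ x⊑y) (S♯-mono err t₂ (S♯-mono ok t₁ x⊑y))
  S♯-mono ok  (t ⋆)     x⊑y = ⋁-mono λ n → iter-mono (S♯-mono ok t) n x⊑y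
  S♯-mono err (t ⋆)     x⊑y = S♯-mono err t (⋁-mono λ n → iter-mono (S♯-mono ok t) n x⊑y)

  ⟦⊕⟧ : ∀ {t₁ t₂} ε → ⟦ t₁ ⊕ t₂ ⟧[ ε ] ≡ ⟦ t₁ ⟧[ ε ] + ⟦ t₂ ⟧[ ε ]
  ⟦⊕⟧ ok  = refl
  ⟦⊕⟧ err = refl

  α⊤-distrib : ∀ x c₁ c₂ → α⊤ (x · (c₁ + c₂)) ≡ α⊤ (x · c₁) ∨A α⊤ (x · c₂)
  α⊤-distrib x c₁ c₂ = trans (cong α⊤ (distribˡ x c₁ c₂)) (α⊤-+ (x · c₁) (x · c₂))

  S♯-sound   : ∀ ε t x → α⊤ (x · ⟦ t ⟧[ ε ]) ⊑ S♯ ε t (α⊤ x)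
  S♯-sound-· : ∀ ε t {x d y} → α⊤ (x · d) ⊑ y → α⊤ (x · (d · ⟦ t ⟧[ ε ])) ⊑ S♯ ε t y
  S♯-sound-⋆ : ∀ t x → α⊤ (x · ⟦ t ⟧[ ok ] *) ⊑ S♯ ok (t ⋆) (α⊤ x)

  S♯-sound ε (atom z) x =
    α-mono (subst (_≤ proj₁ (Aop ⟨⊤ x ⟩) · ⟦ atom z ⟧[ ε ]) (·-assoc ⊤ x _)
                  (·-monoˡ-≤ _ (Aop-extensive ⟨⊤ x ⟩)))
  S♯-sound ε (t₁ ⊕ t₂) x = begin
    α⊤ (x · ⟦ t₁ ⊕ t₂ ⟧[ ε ])                      ≡⟨ cong (α⊤ ∘ (x ·_)) (⟦⊕⟧ ε) ⟩
    α⊤ (x · (⟦ t₁ ⟧[ ε ] + ⟦ t₂ ⟧[ ε ]))           ≡⟨ α⊤-distrib x _ _ ⟩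
    α⊤ (x · ⟦ t₁ ⟧[ ε ]) ∨A α⊤ (x · ⟦ t₂ ⟧[ ε ])  ≤⟨ ∨A-mono (S♯-sound ε t₁ x) (S♯-sound ε t₂ x) ⟩
    S♯ ε (t₁ ⊕ t₂) (α⊤ x)                          ∎
    where open ⊑-Reasoning
  S♯-sound ok  (t₁ ⊙ t₂) x = S♯-sound-· ok t₂ (S♯-sound ok t₁ x)
  S♯-sound err (t₁ ⊙ t₂) x = ⊑.trans (⊑.reflexive (α⊤-distrib x _ _))
    (∨A-mono (S♯-sound err t₁ x) (S♯-sound-· err t₂ (S♯-sound ok t₁ x)))
  S♯-sound ok  (t ⋆) x = S♯-sound-⋆ t x
  S♯-sound err (t ⋆) x = S♯-sound-· err t (S♯-sound-⋆ t x)

  S♯-sound-· ε t {x} {d} xd⊑y =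
    ⊑.trans (⊑.reflexive (cong α⊤ (sym (·-assoc x d _))))
            (⊑.trans (S♯-sound ε t (x · d)) (S♯-mono ε t xd⊑y))

  S♯-sound-⋆ t x = begin
    α⊤ (x · b *)                         ≡⟨ α⊤-⋁ lub ⟩
    ⋁ (λ n → α⊤ (x · b ^ n))             ≤⟨ ⋁-mono below-iterates ⟩
    ⋁ (λ n → iter (S♯ ok t) n (α⊤ x))    ∎
    where
    open ⊑-Reasoning
    b = ⟦ t ⟧[ ok ]
    lub : IsLubOf _≤_ (λ n → ⊤ · (x · b ^ n)) (⊤ · (x · b *))
    lub = IsLubOf-resp (λ n → ·-assoc ⊤ x (b ^ n)) (·-assoc ⊤ x (b *)) (*-lub (⊤ · x) b)
    below-iterates : ∀ n → α⊤ (x · b ^ n) ⊑ iter (S♯ ok t) n (α⊤ x)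
    below-iterates zero    = ⊑.reflexive (cong α⊤ (·-identityʳ x))
    below-iterates (suc n) = ⊑.trans (⊑.reflexive (cong (α⊤ ∘ (x ·_)) (^-suc-comm b n)))
                                     (S♯-sound-· ok t (below-iterates n))

  Valid-intro : ∀ {p q} t ε → ⊤ · q ≤ ⊤ · p · ⟦ t ⟧[ ε ] → S♯ ε t (α⊤ p) ≡ α⊤ q →
                Valid p t ε q
  Valid-intro {p} t ε q≤pt S♯p≡q = q≤pt , S♯p≡q , ⊑.antisym
    (α-mono (≤-trans q≤pt (≤-reflexive (·-assoc ⊤ p _))))
    (⊑.trans (S♯-sound ε t p) (⊑.reflexive S♯p≡q))

  transfer-valid : ∀ {p} x ε → Compl p ⟦ atom x ⟧[ ε ] →
                   Valid p (atom x) ε (p · ⟦ atom x ⟧[ ε ])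
  transfer-valid {p} x ε compl =
    Valid-intro (atom x) ε (≤-reflexive (sym (·-assoc ⊤ p _))) (sym (α-cong-Aop compl))

  relax-valid : ∀ {p p' q q'} t ε →
    ⊤ · p' ≤ ⊤ · p → ⊤ · p ≤ proj₁ (Aop ⟨⊤ p' ⟩) → Valid p' t ε q' →
    ⊤ · q ≤ ⊤ · q' → ⊤ · q' ≤ proj₁ (Aop ⟨⊤ q ⟩) → Valid p t ε q
  relax-valid t ε p'≤p p≤Ap' (q'≤p't , S♯p'≡q' , _) q≤q' q'≤Aq =
    Valid-intro t ε (≤-trans q≤q' (≤-trans q'≤p't (·-monoˡ-≤ _ p'≤p)))
      (trans (cong (S♯ ε t) (α⊤-absorb p'≤p p≤Ap')) (trans S♯p'≡q' (α⊤-absorb q≤q' q'≤Aq)))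

  seq-ok-valid : ∀ {p r q} t₁ t₂ → Valid p t₁ ok r → Valid r t₂ ok q →
                 Valid p (t₁ ⊙ t₂) ok q
  seq-ok-valid t₁ t₂ (r≤pt₁ , S♯p≡r , _) (q≤rt₂ , S♯r≡q , _) =
    Valid-intro (t₁ ⊙ t₂) ok (⊤-reach-· r≤pt₁ q≤rt₂) (trans (cong (S♯ ok t₂) S♯p≡r) S♯r≡q)

  seq-err-valid : ∀ {p q r r'} t₁ t₂ → Valid p t₁ ok q → Valid p t₁ err r →
                  Valid q t₂ err r' → Valid p (t₁ ⊙ t₂) err (r + r')
  seq-err-valid {r = r} {r'} t₁ t₂
                (q≤pt₁ , S♯p≡q , _) (r≤pt₁ , S♯p≡r , _) (r'≤qt₂ , S♯q≡r' , _) =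
    Valid-intro (t₁ ⊙ t₂) err (⊤-reach-+ r≤pt₁ (⊤-reach-· q≤pt₁ r'≤qt₂))
      (trans (cong₂ _∨A_ S♯p≡r (trans (cong (S♯ err t₂) S♯p≡q) S♯q≡r')) (sym (α⊤-+ r r')))

  rec-err-valid : ∀ {p q r} t → Valid p (t ⋆) ok q → Valid q t err r → Valid p (t ⋆) err r
  rec-err-valid t (q≤pt* , S♯p≡q , _) (r≤qt , S♯q≡r , _) =
    Valid-intro (t ⋆) err (⊤-reach-· q≤pt* r≤qt) (trans (cong (S♯ err t) S♯p≡q) S♯q≡r)

  join-valid : ∀ {p q₁ q₂} t₁ t₂ ε → Valid p t₁ ε q₁ → Valid p t₂ ε q₂ →
               Valid p (t₁ ⊕ t₂) ε (q₁ + q₂)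
  join-valid {p} {q₁} {q₂} t₁ t₂ ε (q₁≤pt₁ , S♯p≡q₁ , _) (q₂≤pt₂ , S♯p≡q₂ , _) =
    Valid-intro (t₁ ⊕ t₂) ε
      (subst (λ d → ⊤ · (q₁ + q₂) ≤ ⊤ · p · d) (sym (⟦⊕⟧ ε)) (⊤-reach-+ q₁≤pt₁ q₂≤pt₂))
      (trans (cong₂ _∨A_ S♯p≡q₁ S♯p≡q₂) (sym (α⊤-+ q₁ q₂)))

  limit-valid : ∀ t (as : ℕ → Carrier) {sup} →
    IsLubOf _≤_ (λ n → ⊤ · as n) (⊤ · sup) →
    (∀ n → Valid (as n) t ok (as (suc n))) →
    Valid (as zero) (t ⋆) ok sup
  limit-valid t as lub steps =
    Valid-intro (t ⋆) ok
      (least lub _ λ n → ≤-trans (reach n) (upper (*-lub (⊤ · as zero) b) n))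
      (trans (⋁-cong iterates) (sym (α⊤-⋁ lub)))
    where
    b = ⟦ t ⟧[ ok ]
    step-reach : ∀ {p q} → Valid p t ok q → ⊤ · q ≤ ⊤ · p · b
    step-reach (q≤pb , _ , _) = q≤pb
    step-exact : ∀ {p q} → Valid p t ok q → S♯ ok t (α⊤ p) ≡ α⊤ q
    step-exact (_ , S♯p≡q , _) = S♯p≡q
    reach : ∀ n → ⊤ · as n ≤ ⊤ · as zero · b ^ n
    reach zero    = ≤-reflexive (sym (·-identityʳ _))
    reach (suc n) = subst (λ d → ⊤ · as (suc n) ≤ ⊤ · as zero · d) (sym (^-suc-comm b n))
                          (⊤-reach-· (reach n) (step-reach (steps n)))
    iterates : ∀ n → iter (S♯ ok t) n (α⊤ (as zero)) ≡ α⊤ (as n)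
    iterates zero    = refl
    iterates (suc n) = trans (cong (S♯ ok t) (iterates n)) (step-exact (steps n))

  ⊢⇒Valid : ∀ {p t ε q} → ⊢[ p ] t [ ε ∶ q ] → Valid p t ε q
  ⊢⇒Valid (transfer x ok compl-ok _)   = transfer-valid x ok compl-ok
  ⊢⇒Valid (transfer x err _ compl-err) = transfer-valid x err compl-err
  ⊢⇒Valid {t = t} {ε} (relax p'≤p p≤Ap' d q≤q' q'≤Aq) =
    relax-valid t ε p'≤p p≤Ap' (⊢⇒Valid d) q≤q' q'≤Aq
  ⊢⇒Valid {t = t₁ ⊙ t₂} (seq-ok d₁ d₂) = seq-ok-valid t₁ t₂ (⊢⇒Valid d₁) (⊢⇒Valid d₂)
  ⊢⇒Valid {t = t₁ ⊙ t₂} (seq-err d₁ d₂ d₃) =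
    seq-err-valid t₁ t₂ (⊢⇒Valid d₁) (⊢⇒Valid d₂) (⊢⇒Valid d₃)
  ⊢⇒Valid {t = t ⋆} (rec-err d₁ d₂) = rec-err-valid t (⊢⇒Valid d₁) (⊢⇒Valid d₂)
  ⊢⇒Valid {t = t₁ ⊕ t₂} {ε} (join d₁ d₂) = join-valid t₁ t₂ ε (⊢⇒Valid d₁) (⊢⇒Valid d₂)
  -- Validity does not need the supremum of the aₙ in K itself, only ⊤ ⋁ aₙ = ⋁ ⊤ aₙ.
  ⊢⇒Valid {t = t ⋆} (limit as _ _ ⊤-lub ds) = limit-valid t as ⊤-lub (⊢⇒Valid ∘ ds)

theorem12 : ∀ {c a ℓ s : Level}
    (K : StarContTopKAT c) (D : TopKleeneAbsDomain K a ℓ)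
    (Sig B : Set s) (𝟶 𝟷 : B)
    (u : Sig ⊎ B → StarContTopKAT.Carrier K × StarContTopKAT.Carrier K)
    {p q : StarContTopKAT.Carrier K} {t : Term Sig B} {ε : Exit} →
    Semantics.Abstract.⊢[_]_[_∶_] K u D p t ε q →
    Semantics.Abstract.Valid K u D p t ε q
theorem12 K D Sig B 𝟶 𝟷 u = Soundness.⊢⇒Valid K D u
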